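{- Let $\lambda,\gamma\in\mathbb{N}_0$ with $(\lambda,\gamma)\neq(0,0)$ and $\beta\in\mathbb{N}$ (positive integer), and let $H_n(\lambda,\beta,\gamma)$ denote the coefficient of $\frac{x^n}{n!}$ in $\frac{e^{\gamma x}}{(2-e^{\beta x})^{\lambda}}$. Then for every $n\in\mathbb{N}_0$, $H_n(\lambda,\beta,\gamma)$ equals the number of barred preferential arrangements of $X_n=\{1,\dots,n\}$ with $\lambda$ bars (hence $\lambda+1$ sections) such that the first section has the property that its elements are distributed into $\gamma$ labelled compartments (each of its elements receives a label from $\{1,\dots,\gamma\}$; the section may be empty), and each of the remaining $\lambda$ sections is a (possibly empty) preferential arrangement whose blocks each have $\beta$ labelled compartments (each element of such a section receives a label from $\{1,\dots,\beta\}$).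
   Context: A preferential arrangement of a finite set is an ordered set partition (a sequence of non-empty disjoint blocks whose union is the set). A barred preferential arrangement of $X_n$ with $\xi$ bars consists of $\xi$ identical bars creating $\xi+1$ ordered sections, the elements of $X_n$ being distributed among the sections and each section carrying a (possibly empty) preferential arrangement of its elements. Convention $0^0=1$. -}

module Defs where

open import Data.Nat as ℕ using (ℕ; zero; suc)
open import Data.Nat.Combinatorics using (_C_)
open import Data.Integer as ℤ using (ℤ; +_; _-_)
open import Data.Fin using (Fin)
open import Data.Vec using (Vec; lookup)
open import Data.List using (List; length)
open import Data.List.Relation.Unary.All using (All)
open import Data.List.Relation.Unary.Unique.Propositional using (Unique)
open import Data.List.Membership.Propositional using (_∈_)
open import Data.Product using (Σ; ∃; _×_)
open import Relation.Binary.PropositionalEquality using (_≡_)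

-- Exponential formal power series over ℤ, represented by their sequence
-- of coefficients f n = coefficient of x^n / n!.

EGF : Set
EGF = ℕ → ℤ

sumTo : ℕ → (ℕ → ℤ) → ℤ
sumTo zero    f = f 0
sumTo (suc n) f = sumTo n f ℤ.+ f (suc n)

_⊛_ : EGF → EGF → EGF
(f ⊛ g) n = sumTo n (λ k → + (n C k) ℤ.* f k ℤ.* g (n ℕ.∸ k))

oneS : EGF
oneS zero    = + 1
oneS (suc _) = + 0

_^S_ : EGF → ℕ → EGF
f ^S zero  = oneS
f ^S suc k = f ⊛ (f ^S k)

expS : ℕ → EGF
expS c n = + (c ℕ.^ n)

twoS : EGF
twoS zero    = + 2
twoS (suc _) = + 0

twoMinusExp : ℕ → EGF
twoMinusExp β n = twoS n - expS β n

-- h is the EGF  e^{γx} / (2 - e^{βx})^λ , i.e. h · (2 - e^{βx})^λ = e^{γx}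
IsH : (l β γ : ℕ) → EGF → Set
IsH l β γ h = ∀ n → (h ⊛ (twoMinusExp β ^S l)) n ≡ expS γ n

-- Each element of X_n = Fin n gets a Cell:
--   first c        : element lies in the first section, compartment c ∈ Fin γ
--   later j c b    : element lies in section j+2 (j ∈ Fin λ, i.e. one of the
--                    λ sections after the first), compartment c ∈ Fin β,
--                    and lies in block number b of that section's
--                    preferential arrangement.

data Cell (l β γ : ℕ) : Set where
  first : Fin γ → Cell l β γ
  later : Fin l → Fin β → ℕ → Cell l β γ

-- The blocks of each later section are nonempty and ordered 0,1,...,k-1:
-- the set of block indices used in a section is an initial segment of ℕ.
ValidArr : (l β γ n : ℕ) → Vec (Cell l β γ) n → Set
ValidArr l β γ n v =
  ∀ (i : Fin n) (j : Fin l) (c : Fin β) (b : ℕ) →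
    lookup v i ≡ later j c (suc b) →
    ∃ λ (i' : Fin n) → ∃ λ (c' : Fin β) → lookup v i' ≡ later j c' b

HasCard : {A : Set} → (A → Set) → ℕ → Set
HasCard {A} P m =
  Σ (List A) λ xs →
    Unique xs × All P xs × (∀ x → P x → x ∈ xs) × length xs ≡ m

-- Encode an element of X_n together with its position (first section and compartment, or
-- later section, compartment and block) as a letter, so that arrangements of X_n become
-- words of length n over a finite alphabet.  Words over a disjoint union of two alphabets
-- whose validity splits into that of the two subwords are counted by the product of the
-- exponential generating functions: both sides obey the Leibniz rule for the coefficient
-- shift.  Removing the first block of a nonempty section gives G = 1 + G (e^{βx} − 1) for
-- the series G of sections, i.e. G (2 − e^{βx}) = 1, and splitting off the later sections
-- one by one gives e^{γx} G^λ for the arrangements, which therefore solves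
-- h (2 − e^{βx})^λ = e^{γx}.  That solution is unique because (2 − e^{βx})^λ has constant
-- term 1.

module Submission where

open import Defs
open import Algebra.Bundles using (CommutativeMonoid)
open import Data.Bool using (Bool; true; false; _∧_; _∨_; not; if_then_else_; T)
import Data.Bool.Properties as Bool
open import Data.Bool.ListAction using (all; any; and; or)
open import Data.Empty using (⊥-elim)
open import Data.Fin as Fin using (Fin; toℕ)
import Data.Fin.Properties as Fin
open import Data.Integer as ℤ using (ℤ; +_; -_; _+_; _*_)
import Data.Integer.Properties as ℤ
open import Data.List as List using (List; []; _∷_; _++_; map; length; foldr; concatMap; null; allFin)
import Data.List.Properties as List
open import Data.List.Membership.Propositional using (_∈_; find; lose)
open import Data.List.Membership.Propositional.Properties
  using (∈-map⁺; ∈-map⁻; ∈-++⁺ˡ; ∈-++⁺ʳ; ∈-++⁻; ∈-allFin)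
open import Data.List.Relation.Unary.All as All using ([])
open import Data.List.Relation.Unary.All.Properties using (all⁺; all⁻)
open import Data.List.Relation.Unary.AllPairs using ([]; _∷_)
open import Data.List.Relation.Unary.Any using (here; there)
open import Data.List.Relation.Unary.Any.Properties using (any⁺; any⁻)
open import Data.List.Relation.Unary.Unique.Propositional using (Unique)
import Data.List.Relation.Unary.Unique.Propositional.Properties as Unique
open import Data.Nat as ℕ using (ℕ; zero; suc; _≤_; _<_; z≤n; s≤s; _∸_; _≡ᵇ_)
import Data.Nat.Properties as ℕ
open import Data.Nat.Combinatorics using (_C_; nCn≡1; k>n⇒nCk≡0; nCk+nC[k+1]≡[n+1]C[k+1])
open import Data.Nat.Induction using (<-rec)
open import Data.Nat.ListAction using (sum)
open import Data.Product using (Σ; ∃; ∃₂; _×_; _,_; proj₁; proj₂)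
open import Data.Sum using (_⊎_; inj₁; inj₂)
open import Data.Sum.Properties using (inj₁-injective; inj₂-injective)
open import Data.Unit using (tt)
open import Data.Vec as Vec using (Vec; lookup; toList)
import Data.Vec.Properties as Vec
open import Data.Vec.Membership.Propositional.Properties using (∈-lookup; ∈-toList⁺; ∈-toList⁻)
import Data.Vec.Relation.Unary.Any as VecAny
open import Data.Vec.Relation.Unary.Any.Properties using (lookup-index)
open import Function using (_∘_; id)
open import Relation.Binary.PropositionalEquality
open import Relation.Nullary using (¬_; does; yes)
open import Relation.Nullary.Decidable using (dec-true)
open import Algebra.Properties.AbelianGroup ℤ.+-0-abelianGroup using (∙-cancelˡ)
open import Algebra.Properties.CommutativeSemigroup ℤ.+-commutativeSemigroup
  using (interchange; x∙yz≈y∙xz)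
open import Algebra.Properties.CommutativeSemigroup
  (CommutativeMonoid.commutativeSemigroup Bool.∧-commutativeMonoid)
  using () renaming (x∙yz≈y∙xz to ∧-left-comm)
open import Algebra.Properties.CommutativeSemigroup
  (CommutativeMonoid.commutativeSemigroup Bool.∨-commutativeMonoid)
  using () renaming (x∙yz≈y∙xz to ∨-left-comm)
open ≡-Reasoning

-- Exponential generating functions

sumTo-cong : ∀ n {f g : ℕ → ℤ} → (∀ k → k ≤ n → f k ≡ g k) → sumTo n f ≡ sumTo n g
sumTo-cong zero    f≗g = f≗g 0 z≤n
sumTo-cong (suc n) f≗g =
  cong₂ _+_ (sumTo-cong n (λ k k≤n → f≗g k (ℕ.m≤n⇒m≤1+n k≤n))) (f≗g (suc n) ℕ.≤-refl)

sumTo-+ : ∀ n (f g : ℕ → ℤ) → sumTo n (λ k → f k + g k) ≡ sumTo n f + sumTo n g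
sumTo-+ zero    f g = refl
sumTo-+ (suc n) f g = trans (cong (_+ (f (suc n) + g (suc n))) (sumTo-+ n f g))
                            (interchange (sumTo n f) (sumTo n g) (f (suc n)) (g (suc n)))

sumTo-neg : ∀ n (f : ℕ → ℤ) → sumTo n (λ k → - f k) ≡ - sumTo n f
sumTo-neg zero    f = refl
sumTo-neg (suc n) f =
  trans (cong (_+ - f (suc n)) (sumTo-neg n f)) (sym (ℤ.neg-distrib-+ (sumTo n f) (f (suc n))))

sumTo-zero : ∀ n {f : ℕ → ℤ} → (∀ k → k ≤ n → f k ≡ + 0) → sumTo n f ≡ + 0
sumTo-zero zero    f≗0 = f≗0 0 z≤n
sumTo-zero (suc n) f≗0 =
  cong₂ _+_ (sumTo-zero n (λ k k≤n → f≗0 k (ℕ.m≤n⇒m≤1+n k≤n))) (f≗0 (suc n) ℕ.≤-refl)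

sumTo-uncons : ∀ n (f : ℕ → ℤ) → sumTo (suc n) f ≡ f 0 + sumTo n (f ∘ suc)
sumTo-uncons zero    f = refl
sumTo-uncons (suc n) f =
  trans (cong (_+ f (suc (suc n))) (sumTo-uncons n f)) (ℤ.+-assoc (f 0) _ _)

⊛-term : EGF → EGF → ℕ → ℕ → ℤ
⊛-term f g n k = + (n C k) * f k * g (n ∸ k)

⊛-cong : ∀ n {f f′ g g′ : EGF} →
         (∀ k → k ≤ n → f k ≡ f′ k) → (∀ k → k ≤ n → g k ≡ g′ k) →
         (f ⊛ g) n ≡ (f′ ⊛ g′) n
⊛-cong n f≗f′ g≗g′ = sumTo-cong n λ k k≤n →
  cong₂ (λ a b → + (n C k) * a * b) (f≗f′ k k≤n) (g≗g′ (n ∸ k) (ℕ.m∸n≤m n k))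

⊛-congˡ : ∀ n {f f′ : EGF} (g : EGF) → (∀ k → k ≤ n → f k ≡ f′ k) →
          (f ⊛ g) n ≡ (f′ ⊛ g) n
⊛-congˡ n {f} {f′} g f≗f′ = ⊛-cong n {f} {f′} {g} {g} f≗f′ (λ _ _ → refl)

⊛-congʳ : ∀ n (f : EGF) {g g′ : EGF} → (∀ k → k ≤ n → g k ≡ g′ k) →
          (f ⊛ g) n ≡ (f ⊛ g′) n
⊛-congʳ n f {g} {g′} g≗g′ = ⊛-cong n {f} {f} {g} {g′} (λ _ _ → refl) g≗g′

⊛-distribʳ : ∀ n (f f′ g : EGF) → ((λ k → f k + f′ k) ⊛ g) n ≡ (f ⊛ g) n + (f′ ⊛ g) n
⊛-distribʳ n f f′ g = trans (sumTo-cong n λ k _ → distrib (+ (n C k)) (f k) (f′ k) (g (n ∸ k)))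
                            (sumTo-+ n _ _)
  where
  distrib : ∀ c a a′ d → c * (a + a′) * d ≡ c * a * d + c * a′ * d
  distrib c a a′ d = trans (cong (_* d) (ℤ.*-distribˡ-+ c a a′)) (ℤ.*-distribʳ-+ d (c * a) (c * a′))

⊛-distribˡ : ∀ n (f g g′ : EGF) → (f ⊛ (λ k → g k + g′ k)) n ≡ (f ⊛ g) n + (f ⊛ g′) n
⊛-distribˡ n f g g′ =
  trans (sumTo-cong n λ k _ → ℤ.*-distribˡ-+ (+ (n C k) * f k) (g (n ∸ k)) (g′ (n ∸ k)))
        (sumTo-+ n _ _)

⊛-negʳ : ∀ n (f g : EGF) → (f ⊛ (λ k → - g k)) n ≡ - (f ⊛ g) n
⊛-negʳ n f g =
  trans (sumTo-cong n λ k _ → sym (ℤ.neg-distribʳ-* (+ (n C k) * f k) (g (n ∸ k))))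
        (sumTo-neg n _)

⊛-zeroʳ : ∀ n (f : EGF) → (f ⊛ (λ _ → + 0)) n ≡ + 0
⊛-zeroʳ n f = sumTo-zero n λ k _ → ℤ.*-zeroʳ (+ (n C k) * f k)

⊛-zeroˡ : ∀ n (g : EGF) → ((λ _ → + 0) ⊛ g) n ≡ + 0
⊛-zeroˡ n g = sumTo-zero n λ k _ → cong (_* g (n ∸ k)) (ℤ.*-zeroʳ (+ (n C k)))

⊛-term-last : ∀ n (f g : EGF) → ⊛-term f g n n ≡ f n * g 0
⊛-term-last n f g = begin
  + (n C n) * f n * g (n ∸ n) ≡⟨ cong₂ (λ c m → + c * f n * g m) (nCn≡1 n) (ℕ.n∸n≡0 n) ⟩
  + 1 * f n * g 0             ≡⟨ cong (_* g 0) (ℤ.*-identityˡ (f n)) ⟩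
  f n * g 0                   ∎

⊛-identityˡ : ∀ n (g : EGF) → (oneS ⊛ g) n ≡ g n
⊛-identityˡ zero    g = ℤ.*-identityˡ (g 0)
⊛-identityˡ (suc n) g = begin
  (oneS ⊛ g) (suc n)
    ≡⟨ sumTo-uncons n _ ⟩
  + 1 * + 1 * g (suc n) + sumTo n (⊛-term oneS g (suc n) ∘ suc)
    ≡⟨ cong₂ _+_ (ℤ.*-identityˡ (g (suc n))) above ⟩
  g (suc n) + + 0
    ≡⟨ ℤ.+-identityʳ _ ⟩
  g (suc n) ∎
  where
  above : sumTo n (⊛-term oneS g (suc n) ∘ suc) ≡ + 0
  above = sumTo-zero n λ k _ → cong (_* g (n ∸ k)) (ℤ.*-zeroʳ (+ (suc n C suc k)))

⊛-identityʳ : ∀ n (f : EGF) → (f ⊛ oneS) n ≡ f n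
⊛-identityʳ zero    f = trans (ℤ.*-identityʳ (+ 1 * f 0)) (ℤ.*-identityˡ (f 0))
⊛-identityʳ (suc n) f = begin
  sumTo n (⊛-term f oneS (suc n)) + ⊛-term f oneS (suc n) (suc n)
    ≡⟨ cong₂ _+_ (sumTo-zero n below) (⊛-term-last (suc n) f oneS) ⟩
  + 0 + f (suc n) * + 1
    ≡⟨ trans (ℤ.+-identityˡ _) (ℤ.*-identityʳ (f (suc n))) ⟩
  f (suc n) ∎
  where
  below : ∀ k → k ≤ n → ⊛-term f oneS (suc n) k ≡ + 0
  below k k≤n = begin
    + (suc n C k) * f k * oneS (suc n ∸ k)
      ≡⟨ cong (λ m → + (suc n C k) * f k * oneS m) (ℕ.+-∸-assoc 1 k≤n) ⟩
    + (suc n C k) * f k * + 0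
      ≡⟨ ℤ.*-zeroʳ (+ (suc n C k) * f k) ⟩
    + 0 ∎

shift : EGF → EGF
shift f n = f (suc n)

⊛-shift : ∀ n (f g : EGF) → (f ⊛ g) (suc n) ≡ (shift f ⊛ g) n + (f ⊛ shift g) n
⊛-shift n f g = begin
  sumTo (suc n) (⊛-term f g (suc n))
    ≡⟨ sumTo-uncons n _ ⟩
  r 0 + sumTo n (⊛-term f g (suc n) ∘ suc)
    ≡⟨ cong (_+_ (r 0)) (trans (sumTo-cong n (λ k _ → pascal k)) (sumTo-+ n _ _)) ⟩
  r 0 + ((shift f ⊛ g) n + sumTo n (r ∘ suc))
    ≡⟨ x∙yz≈y∙xz (r 0) ((shift f ⊛ g) n) (sumTo n (r ∘ suc)) ⟩
  (shift f ⊛ g) n + (r 0 + sumTo n (r ∘ suc))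
    ≡⟨ cong (_+_ ((shift f ⊛ g) n)) (sym (sumTo-uncons n r)) ⟩
  (shift f ⊛ g) n + (sumTo n r + r (suc n))
    ≡⟨ cong (_+_ ((shift f ⊛ g) n)) (cong₂ _+_ (sumTo-cong n r≡term) r-top) ⟩
  (shift f ⊛ g) n + ((f ⊛ shift g) n + + 0)
    ≡⟨ cong (_+_ ((shift f ⊛ g) n)) (ℤ.+-identityʳ _) ⟩
  (shift f ⊛ g) n + (f ⊛ shift g) n ∎
  where
  r : ℕ → ℤ
  r k = + (n C k) * f k * g (suc n ∸ k)
  pascal : ∀ k → ⊛-term f g (suc n) (suc k) ≡ ⊛-term (shift f) g n k + r (suc k)
  pascal k = begin
    + (suc n C suc k) * f (suc k) * g (n ∸ k)
      ≡⟨ cong (λ c → + c * f (suc k) * g (n ∸ k)) (sym (nCk+nC[k+1]≡[n+1]C[k+1] n k)) ⟩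
    (+ (n C k) + + (n C suc k)) * f (suc k) * g (n ∸ k)
      ≡⟨ cong (_* g (n ∸ k)) (ℤ.*-distribʳ-+ (f (suc k)) (+ (n C k)) (+ (n C suc k))) ⟩
    (+ (n C k) * f (suc k) + + (n C suc k) * f (suc k)) * g (n ∸ k)
      ≡⟨ ℤ.*-distribʳ-+ (g (n ∸ k)) (+ (n C k) * f (suc k)) (+ (n C suc k) * f (suc k)) ⟩
    ⊛-term (shift f) g n k + r (suc k) ∎
  r≡term : ∀ k → k ≤ n → r k ≡ ⊛-term f (shift g) n k
  r≡term k k≤n = cong (λ m → + (n C k) * f k * g m) (ℕ.+-∸-assoc 1 k≤n)
  r-top : r (suc n) ≡ + 0
  r-top = begin
    + (n C suc n) * f (suc n) * g (n ∸ n)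
      ≡⟨ cong (λ c → + c * f (suc n) * g (n ∸ n)) (k>n⇒nCk≡0 (ℕ.n<1+n n)) ⟩
    + 0 * f (suc n) * g (n ∸ n)
      ≡⟨ cong (_* g (n ∸ n)) (ℤ.*-zeroˡ (f (suc n))) ⟩
    + 0 * g (n ∸ n)
      ≡⟨ ℤ.*-zeroˡ (g (n ∸ n)) ⟩
    + 0 ∎

⊛-assoc : ∀ n (f g h : EGF) → ((f ⊛ g) ⊛ h) n ≡ (f ⊛ (g ⊛ h)) n
⊛-assoc zero    f g h = begin
  ((f ⊛ g) ⊛ h) 0    ≡⟨ ⊛-term-last 0 (f ⊛ g) h ⟩
  (f ⊛ g) 0 * h 0    ≡⟨ cong (_* h 0) (⊛-term-last 0 f g) ⟩
  f 0 * g 0 * h 0    ≡⟨ ℤ.*-assoc (f 0) (g 0) (h 0) ⟩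
  f 0 * (g 0 * h 0)  ≡⟨ cong (f 0 *_) (⊛-term-last 0 g h) ⟨
  f 0 * (g ⊛ h) 0    ≡⟨ ⊛-term-last 0 f (g ⊛ h) ⟨
  (f ⊛ (g ⊛ h)) 0    ∎
⊛-assoc (suc n) f g h = begin
  ((f ⊛ g) ⊛ h) (suc n)
    ≡⟨ ⊛-shift n (f ⊛ g) h ⟩
  (shift (f ⊛ g) ⊛ h) n + ((f ⊛ g) ⊛ shift h) n
    ≡⟨ cong (_+ ((f ⊛ g) ⊛ shift h) n)
            (trans (⊛-congˡ n h (λ k _ → ⊛-shift k f g))
                   (⊛-distribʳ n (shift f ⊛ g) (f ⊛ shift g) h)) ⟩
  ((shift f ⊛ g) ⊛ h) n + ((f ⊛ shift g) ⊛ h) n + ((f ⊛ g) ⊛ shift h) n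
    ≡⟨ cong₂ _+_ (cong₂ _+_ (⊛-assoc n (shift f) g h) (⊛-assoc n f (shift g) h))
                 (⊛-assoc n f g (shift h)) ⟩
  (shift f ⊛ (g ⊛ h)) n + (f ⊛ (shift g ⊛ h)) n + (f ⊛ (g ⊛ shift h)) n
    ≡⟨ ℤ.+-assoc ((shift f ⊛ (g ⊛ h)) n) ((f ⊛ (shift g ⊛ h)) n) ((f ⊛ (g ⊛ shift h)) n) ⟩
  (shift f ⊛ (g ⊛ h)) n + ((f ⊛ (shift g ⊛ h)) n + (f ⊛ (g ⊛ shift h)) n)
    ≡⟨ cong (_+_ ((shift f ⊛ (g ⊛ h)) n))
            (sym (trans (⊛-congʳ n f (λ k _ → ⊛-shift k g h))
                        (⊛-distribˡ n f (shift g ⊛ h) (g ⊛ shift h)))) ⟩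
  (shift f ⊛ (g ⊛ h)) n + (f ⊛ shift (g ⊛ h)) n
    ≡⟨ sym (⊛-shift n f (g ⊛ h)) ⟩
  (f ⊛ (g ⊛ h)) (suc n) ∎

^S-constant : (f : EGF) → f 0 ≡ + 1 → ∀ l → (f ^S l) 0 ≡ + 1
^S-constant f f₀≡1 zero    = refl
^S-constant f f₀≡1 (suc l) = begin
  (f ⊛ (f ^S l)) 0   ≡⟨ ⊛-term-last 0 f (f ^S l) ⟩
  f 0 * (f ^S l) 0   ≡⟨ cong₂ _*_ f₀≡1 (^S-constant f f₀≡1 l) ⟩
  + 1                ∎

-- (f ⊛ p) n is f n plus terms involving only f k with k < n.
⊛-cancelʳ : ∀ {f g : EGF} (p : EGF) → p 0 ≡ + 1 →
            (∀ n → (f ⊛ p) n ≡ (g ⊛ p) n) → ∀ n → f n ≡ g n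
⊛-cancelʳ {f} {g} p p₀≡1 f⊛p≗g⊛p = <-rec _ step
  where
  last : ∀ n (h : EGF) → ⊛-term h p n n ≡ h n
  last n h = trans (⊛-term-last n h p) (trans (cong (h n *_) p₀≡1) (ℤ.*-identityʳ (h n)))
  step : ∀ n → (∀ {m} → m < n → f m ≡ g m) → f n ≡ g n
  step zero    _  = begin
    f 0         ≡⟨ last 0 f ⟨
    (f ⊛ p) 0   ≡⟨ f⊛p≗g⊛p 0 ⟩
    (g ⊛ p) 0   ≡⟨ last 0 g ⟩
    g 0         ∎
  step (suc n) ih = ∙-cancelˡ (sumTo n (⊛-term f p (suc n))) (f (suc n)) (g (suc n)) (begin
    sumTo n (⊛-term f p (suc n)) + f (suc n)
      ≡⟨ cong (_+_ (sumTo n (⊛-term f p (suc n)))) (last (suc n) f) ⟨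
    (f ⊛ p) (suc n)
      ≡⟨ f⊛p≗g⊛p (suc n) ⟩
    sumTo n (⊛-term g p (suc n)) + ⊛-term g p (suc n) (suc n)
      ≡⟨ cong₂ _+_ (sumTo-cong n λ k k≤n →
                      cong (λ x → + (suc n C k) * x * p (suc n ∸ k)) (sym (ih (s≤s k≤n))))
                   (last (suc n) g) ⟩
    sumTo n (⊛-term f p (suc n)) + g (suc n) ∎)

IsH-unique : ∀ l β γ {h h′ : EGF} → IsH l β γ h → IsH l β γ h′ → ∀ n → h n ≡ h′ n
IsH-unique l β γ h-isH h′-isH = ⊛-cancelʳ (twoMinusExp β ^S l) (^S-constant (twoMinusExp β) refl l)
  (λ n → trans (h-isH n) (sym (h′-isH n)))

-- Counting and listing words

lefts : {A B : Set} → List (A ⊎ B) → List A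
lefts []           = []
lefts (inj₁ a ∷ v) = a ∷ lefts v
lefts (inj₂ _ ∷ v) = lefts v

rights : {A B : Set} → List (A ⊎ B) → List B
rights []           = []
rights (inj₁ _ ∷ v) = rights v
rights (inj₂ b ∷ v) = b ∷ rights v

count : {X : Set} → List X → ℕ → (List X → Bool) → ℕ
count xs zero    P = if P [] then 1 else 0
count xs (suc n) P = sum (map (λ x → count xs n (P ∘ (x ∷_))) xs)

countEGF : {X : Set} → List X → (List X → Bool) → EGF
countEGF xs P n = + count xs n P

count-map : {X Y : Set} → ∀ n (f : X → Y) (xs : List X) (P : List Y → Bool) →
            count (map f xs) n P ≡ count xs n (P ∘ map f)
count-map zero    f xs P = refl
count-map (suc n) f xs P = cong sum (begin
  map (λ y → count (map f xs) n (P ∘ (y ∷_))) (map f xs)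
    ≡⟨ List.map-∘ xs ⟨
  map (λ x → count (map f xs) n (P ∘ (f x ∷_))) xs
    ≡⟨ List.map-cong (λ x → count-map n f xs (P ∘ (f x ∷_))) xs ⟩
  map (λ x → count xs n (P ∘ map f ∘ (x ∷_))) xs ∎)

count-cong : {X : Set} → ∀ n (xs : List X) {P Q : List X → Bool} →
             (∀ v → length v ≡ n → P v ≡ Q v) → count xs n P ≡ count xs n Q
count-cong zero    xs P≗Q = cong (if_then 1 else 0) (P≗Q [] refl)
count-cong (suc n) xs P≗Q =
  cong sum (List.map-cong (λ x → count-cong n xs (λ v ∣v∣≡n → P≗Q (x ∷ v) (cong suc ∣v∣≡n))) xs)

count-true : {X : Set} → ∀ n (xs : List X) → count xs n (λ _ → true) ≡ length xs ℕ.^ n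
count-true zero    xs = refl
count-true (suc n) xs = trans (cong sum (List.map-cong (λ _ → count-true n xs) xs)) (sum-const xs)
  where
  sum-const : ∀ ys → sum (map (λ _ → length xs ℕ.^ n) ys) ≡ length ys ℕ.* (length xs ℕ.^ n)
  sum-const []       = refl
  sum-const (_ ∷ ys) = cong (length xs ℕ.^ n ℕ.+_) (sum-const ys)

sumᶻ : List ℤ → ℤ
sumᶻ = foldr _+_ (+ 0)

sumᶻ-++ : ∀ ms ns → sumᶻ (ms ++ ns) ≡ sumᶻ ms + sumᶻ ns
sumᶻ-++ []       ns = sym (ℤ.+-identityˡ (sumᶻ ns))
sumᶻ-++ (m ∷ ms) ns = trans (cong (_+_ m) (sumᶻ-++ ms ns)) (sym (ℤ.+-assoc m (sumᶻ ms) (sumᶻ ns)))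

pos-sum : ∀ ns → + sum ns ≡ sumᶻ (map +_ ns)
pos-sum []       = refl
pos-sum (n ∷ ns) = trans (ℤ.pos-+ n (sum ns)) (cong (_+_ (+ n)) (pos-sum ns))

countEGF-suc : {X : Set} (xs : List X) (P : List X → Bool) → ∀ n →
               countEGF xs P (suc n) ≡ sumᶻ (map (λ x → countEGF xs (P ∘ (x ∷_)) n) xs)
countEGF-suc {X} xs P n = trans (pos-sum (map c xs)) (cong sumᶻ (sym (List.map-∘ xs)))
  where
  c : X → ℕ
  c x = count xs n (P ∘ (x ∷_))

⊛-sumᶻˡ : {X : Set} → ∀ n (F : X → EGF) (g : EGF) (xs : List X) →
          sumᶻ (map (λ x → (F x ⊛ g) n) xs) ≡ ((λ k → sumᶻ (map (λ x → F x k) xs)) ⊛ g) n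
⊛-sumᶻˡ n F g []       = sym (⊛-zeroˡ n g)
⊛-sumᶻˡ n F g (x ∷ xs) = trans (cong (_+_ ((F x ⊛ g) n)) (⊛-sumᶻˡ n F g xs))
                               (sym (⊛-distribʳ n (F x) (λ k → sumᶻ (map (λ y → F y k) xs)) g))

⊛-sumᶻʳ : {X : Set} → ∀ n (f : EGF) (G : X → EGF) (xs : List X) →
          sumᶻ (map (λ x → (f ⊛ G x) n) xs) ≡ (f ⊛ (λ k → sumᶻ (map (λ x → G x k) xs))) n
⊛-sumᶻʳ n f G []       = sym (⊛-zeroʳ n f)
⊛-sumᶻʳ n f G (x ∷ xs) = trans (cong (_+_ ((f ⊛ G x) n)) (⊛-sumᶻʳ n f G xs))
                               (sym (⊛-distribˡ n f (G x) (λ k → sumᶻ (map (λ y → G y k) xs))))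

-- By the Leibniz rule for `shift` it suffices to split off the first letter.
count-⊎ : {A B : Set} → ∀ n (as : List A) (bs : List B) (P : List A → Bool) (Q : List B → Bool) →
          countEGF (map inj₁ as ++ map inj₂ bs) (λ v → P (lefts v) ∧ Q (rights v)) n
          ≡ (countEGF as P ⊛ countEGF bs Q) n
count-⊎ zero as bs P Q with P [] | Q []
... | true  | true  = refl
... | true  | false = refl
... | false | _     = refl
count-⊎ {A} {B} (suc n) as bs P Q = begin
  countEGF alphabet R (suc n)
    ≡⟨ countEGF-suc alphabet R n ⟩
  sumᶻ (map F (map inj₁ as ++ map inj₂ bs))
    ≡⟨ trans (cong sumᶻ (List.map-++ F (map inj₁ as) (map inj₂ bs)))
             (sumᶻ-++ (map F (map inj₁ as)) (map F (map inj₂ bs))) ⟩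
  sumᶻ (map F (map inj₁ as)) + sumᶻ (map F (map inj₂ bs))
    ≡⟨ cong₂ _+_ (cong sumᶻ (List.map-∘ as)) (cong sumᶻ (List.map-∘ bs)) ⟨
  sumᶻ (map (F ∘ inj₁) as) + sumᶻ (map (F ∘ inj₂) bs)
    ≡⟨ cong₂ _+_ (cong sumᶻ (List.map-cong (λ a → count-⊎ n as bs (P ∘ (a ∷_)) Q) as))
                 (cong sumᶻ (List.map-cong (λ b → count-⊎ n as bs P (Q ∘ (b ∷_))) bs)) ⟩
  sumᶻ (map (λ a → (countEGF as (P ∘ (a ∷_)) ⊛ countEGF bs Q) n) as)
    + sumᶻ (map (λ b → (countEGF as P ⊛ countEGF bs (Q ∘ (b ∷_))) n) bs)
    ≡⟨ cong₂ _+_ (⊛-sumᶻˡ n (λ a → countEGF as (P ∘ (a ∷_))) (countEGF bs Q) as)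
                 (⊛-sumᶻʳ n (countEGF as P) (λ b → countEGF bs (Q ∘ (b ∷_))) bs) ⟩
  ((λ k → sumᶻ (map (λ a → countEGF as (P ∘ (a ∷_)) k) as)) ⊛ countEGF bs Q) n
    + (countEGF as P ⊛ (λ k → sumᶻ (map (λ b → countEGF bs (Q ∘ (b ∷_)) k) bs))) n
    ≡⟨ cong₂ _+_ (⊛-congˡ n (countEGF bs Q) (λ k _ → countEGF-suc as P k))
                 (⊛-congʳ n (countEGF as P) (λ k _ → countEGF-suc bs Q k)) ⟨
  (shift (countEGF as P) ⊛ countEGF bs Q) n + (countEGF as P ⊛ shift (countEGF bs Q)) n
    ≡⟨ ⊛-shift n (countEGF as P) (countEGF bs Q) ⟨
  (countEGF as P ⊛ countEGF bs Q) (suc n) ∎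
  where
  alphabet : List (A ⊎ B)
  alphabet = map inj₁ as ++ map inj₂ bs
  R : List (A ⊎ B) → Bool
  R v = P (lefts v) ∧ Q (rights v)
  F : A ⊎ B → ℤ
  F x = countEGF alphabet (R ∘ (x ∷_)) n

words : {X : Set} → List X → (n : ℕ) → (List X → Bool) → List (Vec X n)
wordsStartingWith : {X : Set} → List X → (n : ℕ) → (List X → Bool) → X → List (Vec X (suc n))

words xs zero    P = if P [] then Vec.[] ∷ [] else []
words xs (suc n) P = concatMap (wordsStartingWith xs n P) xs

wordsStartingWith xs n P x = map (x Vec.∷_) (words xs n (P ∘ (x ∷_)))

length-words : {X : Set} (xs : List X) (n : ℕ) (P : List X → Bool) →
               length (words xs n P) ≡ count xs n P
length-words xs zero P with P []
... | true  = refl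
... | false = refl
length-words xs (suc n) P = go xs
  where
  go : ∀ ys → length (concatMap (wordsStartingWith xs n P) ys)
              ≡ sum (map (λ x → count xs n (P ∘ (x ∷_))) ys)
  go []       = refl
  go (y ∷ ys) = trans (List.length-++ (wordsStartingWith xs n P y))
    (cong₂ ℕ._+_ (trans (List.length-map _ (words xs n _)) (length-words xs n _)) (go ys))

words-sound : {X : Set} (xs : List X) (n : ℕ) (P : List X → Bool) {v : Vec X n} →
              v ∈ words xs n P → T (P (toList v))
words-sound xs zero P {Vec.[]} v∈ with P []
... | true  = _
... | false with () ← v∈
words-sound {X} xs (suc n) P = go xs
  where
  go : ∀ ys {v : Vec X (suc n)} → v ∈ concatMap (wordsStartingWith xs n P) ys → T (P (toList v))
  go (y ∷ ys) v∈ with ∈-++⁻ (wordsStartingWith xs n P y) v∈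
  ... | inj₂ v∈ys = go ys v∈ys
  ... | inj₁ v∈y with ∈-map⁻ (y Vec.∷_) v∈y
  ...   | w , w∈ , refl = words-sound xs n (P ∘ (y ∷_)) w∈

words-complete : {X : Set} (xs : List X) (n : ℕ) (P : List X → Bool) (v : Vec X n) →
                 (∀ i → lookup v i ∈ xs) → T (P (toList v)) → v ∈ words xs n P
words-complete xs zero P Vec.[] _ Pv with P []
... | true = here refl
words-complete xs (suc n) P (y Vec.∷ v) v⊆xs Pv = go xs (v⊆xs Fin.zero)
  where
  go : ∀ ys → y ∈ ys → (y Vec.∷ v) ∈ concatMap (wordsStartingWith xs n P) ys
  go (z ∷ ys) (here refl) =
    ∈-++⁺ˡ (∈-map⁺ (y Vec.∷_) (words-complete xs n (P ∘ (y ∷_)) v (v⊆xs ∘ Fin.suc) Pv))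
  go (z ∷ ys) (there y∈)  = ∈-++⁺ʳ (wordsStartingWith xs n P z) (go ys y∈)

words-unique : {X : Set} (xs : List X) (n : ℕ) (P : List X → Bool) → Unique xs → Unique (words xs n P)
words-unique xs zero P _ with P []
... | true  = [] ∷ []
... | false = []
words-unique {X} xs (suc n) P xs! = go xs xs!
  where
  head∈ : ∀ ys {v} → v ∈ concatMap (wordsStartingWith xs n P) ys → Vec.head v ∈ ys
  head∈ (y ∷ ys) v∈ with ∈-++⁻ (wordsStartingWith xs n P y) v∈
  ... | inj₂ v∈ys = there (head∈ ys v∈ys)
  ... | inj₁ v∈y with ∈-map⁻ (y Vec.∷_) v∈y
  ...   | _ , _ , refl = here refl
  go : ∀ ys → Unique ys → Unique (concatMap (wordsStartingWith xs n P) ys)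
  go []       _            = []
  go (y ∷ ys) (y∉ys ∷ ys!) =
    Unique.++⁺ (Unique.map⁺ Vec.∷-injectiveʳ (words-unique xs n _ xs!)) (go ys ys!) disjoint
    where
    disjoint : ∀ {v} → ¬ (v ∈ wordsStartingWith xs n P y × v ∈ concatMap (wordsStartingWith xs n P) ys)
    disjoint (v∈y , v∈ys) with ∈-map⁻ (y Vec.∷_) v∈y
    ... | _ , _ , refl = All.lookup y∉ys (head∈ ys v∈ys) refl

∈-toList⇒lookup : {X : Set} {n : ℕ} (v : Vec X n) {x : X} → x ∈ toList v →
                  ∃ λ i → lookup v i ≡ x
∈-toList⇒lookup v x∈v = let p = ∈-toList⁻ x∈v in VecAny.index p , sym (lookup-index p)

count-hasCard : {X : Set} {n : ℕ} (xs : List X) (P : List X → Bool) {Valid : Vec X n → Set} →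
                Unique xs → (∀ {v} → Valid v → ∀ i → lookup v i ∈ xs) →
                (∀ {v} → Valid v → T (P (toList v))) → (∀ {v} → T (P (toList v)) → Valid v) →
                HasCard Valid (count xs n P)
count-hasCard {n = n} xs P xs! valid⇒∈ valid⇒P P⇒valid =
  words xs n P ,
  words-unique xs n P xs! ,
  All.tabulate (P⇒valid ∘ words-sound xs n P) ,
  (λ v valid → words-complete xs n P v (valid⇒∈ valid) (valid⇒P valid)) ,
  length-words xs n P

Unique-⊎ : {A B : Set} {as : List A} {bs : List B} → Unique as → Unique bs →
           Unique (map inj₁ as ++ map inj₂ bs)
Unique-⊎ {as = as} {bs} as! bs! =
  Unique.++⁺ (Unique.map⁺ inj₁-injective as!) (Unique.map⁺ inj₂-injective bs!) disjoint
  where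
  disjoint : ∀ {v} → ¬ (v ∈ map inj₁ as × v ∈ map inj₂ bs)
  disjoint (v∈as , v∈bs) with ∈-map⁻ inj₁ v∈as | ∈-map⁻ inj₂ v∈bs
  ... | _ , _ , refl | _ , _ , ()

module _ {A B : Set} where

  all-map : (p : B → Bool) (f : A → B) (w : List A) → all p (map f w) ≡ all (p ∘ f) w
  all-map p f w = cong and (sym (List.map-∘ w))

  any-map : (p : B → Bool) (f : A → B) (w : List A) → any p (map f w) ≡ any (p ∘ f) w
  any-map p f w = cong or (sym (List.map-∘ w))

  all-partition : (p : A ⊎ B → Bool) (v : List (A ⊎ B)) →
                  all p v ≡ all (p ∘ inj₁) (lefts v) ∧ all (p ∘ inj₂) (rights v)
  all-partition p []           = refl
  all-partition p (inj₁ a ∷ v) =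
    trans (cong (p (inj₁ a) ∧_) (all-partition p v)) (sym (Bool.∧-assoc (p (inj₁ a)) _ _))
  all-partition p (inj₂ b ∷ v) =
    trans (cong (p (inj₂ b) ∧_) (all-partition p v))
          (∧-left-comm (p (inj₂ b)) (all (p ∘ inj₁) (lefts v)) (all (p ∘ inj₂) (rights v)))

  any-partition : (p : A ⊎ B → Bool) (v : List (A ⊎ B)) →
                  any p v ≡ any (p ∘ inj₁) (lefts v) ∨ any (p ∘ inj₂) (rights v)
  any-partition p []           = refl
  any-partition p (inj₁ a ∷ v) =
    trans (cong (p (inj₁ a) ∨_) (any-partition p v)) (sym (Bool.∨-assoc (p (inj₁ a)) _ _))
  any-partition p (inj₂ b ∷ v) =
    trans (cong (p (inj₂ b) ∨_) (any-partition p v))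
          (∨-left-comm (p (inj₂ b)) (any (p ∘ inj₁) (lefts v)) (any (p ∘ inj₂) (rights v)))

module _ {A : Set} where

  all-cong : {p q : A → Bool} (w : List A) → (∀ x → p x ≡ q x) → all p w ≡ all q w
  all-cong w p≗q = cong and (List.map-cong p≗q w)

  any-cong : {p q : A → Bool} (w : List A) → (∀ x → p x ≡ q x) → any p w ≡ any q w
  any-cong w p≗q = cong or (List.map-cong p≗q w)

  all-true : (w : List A) → all (λ _ → true) w ≡ true
  all-true []      = refl
  all-true (_ ∷ w) = all-true w

  any-false : (w : List A) → any (λ _ → false) w ≡ false
  any-false []      = refl
  any-false (_ ∷ w) = any-false w

  any-true : (w : List A) → any (λ _ → true) w ≡ not (null w)
  any-true []      = refl
  any-true (_ ∷ w) = refl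

-- Sections and arrangements as words of cells

module Sections (β : ℕ) where

  -- (c , b): compartment c and block b, as in `later j c b`
  SectionCell : Set
  SectionCell = Fin β × ℕ

  inBlockᵇ : ℕ → SectionCell → Bool
  inBlockᵇ b (_ , b′) = b ≡ᵇ b′

  supportedᵇ : SectionCell → List SectionCell → Bool
  supportedᵇ (_ , zero)  w = true
  supportedᵇ (_ , suc b) w = any (inBlockᵇ b) w

  sectionᵇ : List SectionCell → Bool
  sectionᵇ w = all (λ x → supportedᵇ x w) w

  sectionᵇ-block₀ : {w : List SectionCell} → T (sectionᵇ w) →
                    ∀ {c b} → (c , b) ∈ w → ∃ λ c′ → (c′ , 0) ∈ w
  sectionᵇ-block₀ {w} valid = descend _
    where
    descend : ∀ b {c} → (c , b) ∈ w → ∃ λ c′ → (c′ , 0) ∈ w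
    descend zero    x∈w = _ , x∈w
    descend (suc b) x∈w with find (any⁻ (inBlockᵇ b) w (All.lookup (all⁺ _ w valid) x∈w))
    ... | (c′ , b′) , y∈w , b≡ᵇb′ with ℕ.≡ᵇ⇒≡ b b′ b≡ᵇb′
    ...   | refl = descend b y∈w

  pushBlock : SectionCell ⊎ Fin β → SectionCell
  pushBlock (inj₁ (c , b)) = c , suc b
  pushBlock (inj₂ c)       = c , 0

  -- blocks below B only, so that the alphabet is finite
  sectionCells : ℕ → List SectionCell
  sectionCells zero    = []
  sectionCells (suc B) = map pushBlock (map inj₁ (sectionCells B) ++ map inj₂ (allFin β))

  popBlock : SectionCell → SectionCell ⊎ Fin β
  popBlock (c , zero)  = inj₂ c
  popBlock (c , suc b) = inj₁ (c , b)

  popBlock-pushBlock : ∀ x → popBlock (pushBlock x) ≡ x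
  popBlock-pushBlock (inj₁ _) = refl
  popBlock-pushBlock (inj₂ _) = refl

  pushBlock-injective : ∀ {x y} → pushBlock x ≡ pushBlock y → x ≡ y
  pushBlock-injective {x} {y} eq =
    trans (sym (popBlock-pushBlock x)) (trans (cong popBlock eq) (popBlock-pushBlock y))

  sectionCells-unique : ∀ B → Unique (sectionCells B)
  sectionCells-unique zero    = []
  sectionCells-unique (suc B) =
    Unique.map⁺ pushBlock-injective (Unique-⊎ (sectionCells-unique B) (Unique.allFin⁺ β))

  sectionCells-complete : ∀ B c b → b < B → (c , b) ∈ sectionCells B
  sectionCells-complete (suc B) c zero    _         =
    ∈-map⁺ pushBlock (∈-++⁺ʳ (map inj₁ (sectionCells B)) (∈-map⁺ inj₂ (∈-allFin c)))
  sectionCells-complete (suc B) c (suc b) (s≤s b<B) =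
    ∈-map⁺ pushBlock (∈-++⁺ˡ (∈-map⁺ inj₁ (sectionCells-complete B c b b<B)))

  private
    supportedOrᵇ : Bool → List SectionCell → SectionCell → Bool
    supportedOrᵇ e w (_ , zero)  = e
    supportedOrᵇ e w (c , suc b) = supportedᵇ (c , suc b) w

    all-supportedOrᵇ : ∀ e w → w ≢ [] ⊎ T e → all (supportedOrᵇ e w) w ≡ sectionᵇ w ∧ e
    all-supportedOrᵇ true  w _ =
      trans (all-cong w λ { (_ , zero) → refl ; (_ , suc _) → refl }) (sym (Bool.∧-identityʳ _))
    all-supportedOrᵇ false [] (inj₁ []≢[]) = ⊥-elim ([]≢[] refl)
    all-supportedOrᵇ false w@(x ∷ _) _ with all (supportedOrᵇ false w) w in eq
    ... | false = sym (Bool.∧-zeroʳ (sectionᵇ w))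
    ... | true  = ⊥-elim (All.lookup supported (proj₂ (sectionᵇ-block₀ valid (here refl))))
      where
      supported : All.All (T ∘ supportedOrᵇ false w) w
      supported = all⁺ _ w (subst T (sym eq) tt)
      weaken : ∀ y → T (supportedOrᵇ false w y) → T (supportedᵇ y w)
      weaken (_ , suc _) s = s
      valid : T (sectionᵇ w)
      valid = all⁻ (λ y → supportedᵇ y w) (All.map (λ {y} → weaken y) supported)

  -- After the shift, old block-0 cells need the new first block to be nonempty;
  -- if it is empty, the rest has no block 0 and so is no section (`sectionᵇ-block₀`).
  sectionᵇ-pushBlock : (u : List (SectionCell ⊎ Fin β)) → u ≢ [] →
                       sectionᵇ (map pushBlock u) ≡ sectionᵇ (lefts u) ∧ not (null (rights u))
  sectionᵇ-pushBlock u u≢[] = begin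
    all (λ x → supportedᵇ x W) (map pushBlock u)
      ≡⟨ all-map (λ x → supportedᵇ x W) pushBlock u ⟩
    all (λ y → supportedᵇ (pushBlock y) W) u
      ≡⟨ all-partition (λ y → supportedᵇ (pushBlock y) W) u ⟩
    all (λ s → supportedᵇ (pushBlock (inj₁ s)) W) (lefts u) ∧ all (λ _ → true) (rights u)
      ≡⟨ cong₂ _∧_ (all-cong (lefts u) lowered) (all-true (rights u)) ⟩
    all (supportedOrᵇ e (lefts u)) (lefts u) ∧ true
      ≡⟨ Bool.∧-identityʳ _ ⟩
    all (supportedOrᵇ e (lefts u)) (lefts u)
      ≡⟨ all-supportedOrᵇ e (lefts u) (nonEmpty u u≢[]) ⟩
    sectionᵇ (lefts u) ∧ e ∎
    where
    W : List SectionCell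
    W = map pushBlock u
    e : Bool
    e = not (null (rights u))
    lowered : ∀ s → supportedᵇ (pushBlock (inj₁ s)) W ≡ supportedOrᵇ e (lefts u) s
    lowered (c , zero)  = begin
      any (inBlockᵇ 0) (map pushBlock u)
        ≡⟨ any-map (inBlockᵇ 0) pushBlock u ⟩
      any (inBlockᵇ 0 ∘ pushBlock) u
        ≡⟨ any-partition (inBlockᵇ 0 ∘ pushBlock) u ⟩
      any (inBlockᵇ 0 ∘ pushBlock ∘ inj₁) (lefts u) ∨ any (λ _ → true) (rights u)
        ≡⟨ cong₂ _∨_ (trans (any-cong (lefts u) λ { (_ , _) → refl }) (any-false (lefts u)))
                     (any-true (rights u)) ⟩
      e ∎
    lowered (c , suc b) = begin
      any (inBlockᵇ (suc b)) (map pushBlock u)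
        ≡⟨ any-map (inBlockᵇ (suc b)) pushBlock u ⟩
      any (inBlockᵇ (suc b) ∘ pushBlock) u
        ≡⟨ any-partition (inBlockᵇ (suc b) ∘ pushBlock) u ⟩
      any (inBlockᵇ (suc b) ∘ pushBlock ∘ inj₁) (lefts u) ∨ any (λ _ → false) (rights u)
        ≡⟨ cong₂ _∨_ (any-cong (lefts u) λ { (_ , _) → refl }) (any-false (rights u)) ⟩
      any (inBlockᵇ b) (lefts u) ∨ false
        ≡⟨ Bool.∨-identityʳ _ ⟩
      any (inBlockᵇ b) (lefts u) ∎
    nonEmpty : ∀ u → u ≢ [] → lefts u ≢ [] ⊎ T (not (null (rights u)))
    nonEmpty []           []≢[] = ⊥-elim ([]≢[] refl)
    nonEmpty (inj₁ _ ∷ _) _     = inj₁ λ ()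
    nonEmpty (inj₂ _ ∷ _) _     = inj₂ tt

module Arrangements (β γ : ℕ) where

  open Sections β

  inSectionBlockᵇ : {l : ℕ} → Fin l → ℕ → Cell l β γ → Bool
  inSectionBlockᵇ j b (first _)       = false
  inSectionBlockᵇ j b (later j′ _ b′) = does (j Fin.≟ j′) ∧ (b ≡ᵇ b′)

  cellSupportedᵇ : {l : ℕ} → Cell l β γ → List (Cell l β γ) → Bool
  cellSupportedᵇ (first _)           w = true
  cellSupportedᵇ (later _ _ zero)    w = true
  cellSupportedᵇ (later j _ (suc b)) w = any (inSectionBlockᵇ j b) w

  arrangementᵇ : {l : ℕ} → List (Cell l β γ) → Bool
  arrangementᵇ w = all (λ x → cellSupportedᵇ x w) w

  pushSection : {l : ℕ} → Cell l β γ ⊎ SectionCell → Cell (suc l) β γ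
  pushSection (inj₁ (first c))     = first c
  pushSection (inj₁ (later j c b)) = later (Fin.suc j) c b
  pushSection (inj₂ (c , b))       = later Fin.zero c b

  cells : (l B : ℕ) → List (Cell l β γ)
  cells zero    B = map first (allFin γ)
  cells (suc l) B = map pushSection (map inj₁ (cells l B) ++ map inj₂ (sectionCells B))

  popSection : {l : ℕ} → Cell (suc l) β γ → Cell l β γ ⊎ SectionCell
  popSection (first c)                = inj₁ (first c)
  popSection (later Fin.zero c b)     = inj₂ (c , b)
  popSection (later (Fin.suc j) c b)  = inj₁ (later j c b)

  popSection-pushSection : {l : ℕ} (x : Cell l β γ ⊎ SectionCell) → popSection (pushSection x) ≡ x
  popSection-pushSection (inj₁ (first _))     = refl
  popSection-pushSection (inj₁ (later _ _ _)) = refl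
  popSection-pushSection (inj₂ _)             = refl

  pushSection-injective : {l : ℕ} {x y : Cell l β γ ⊎ SectionCell} →
                          pushSection x ≡ pushSection y → x ≡ y
  pushSection-injective {x = x} {y} eq =
    trans (sym (popSection-pushSection x)) (trans (cong popSection eq) (popSection-pushSection y))

  first-injective : {c c′ : Fin γ} → first {0} {β} c ≡ first c′ → c ≡ c′
  first-injective refl = refl

  cells-unique : ∀ l B → Unique (cells l B)
  cells-unique zero    B = Unique.map⁺ first-injective (Unique.allFin⁺ γ)
  cells-unique (suc l) B =
    Unique.map⁺ pushSection-injective (Unique-⊎ (cells-unique l B) (sectionCells-unique B))

  cells-complete : ∀ l B (x : Cell l β γ) → (∀ {j c b} → x ≡ later j c b → b < B) → x ∈ cells l B
  cells-complete zero    B (first c)                 _     = ∈-map⁺ first (∈-allFin c)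
  cells-complete (suc l) B (first c)                 _     =
    ∈-map⁺ pushSection (∈-++⁺ˡ (∈-map⁺ inj₁ (cells-complete l B (first c) λ ())))
  cells-complete (suc l) B (later Fin.zero c b)      b<B   =
    ∈-map⁺ pushSection (∈-++⁺ʳ (map inj₁ (cells l B))
                               (∈-map⁺ inj₂ (sectionCells-complete B c b (b<B refl))))
  cells-complete (suc l) B (later (Fin.suc j) c b)   b<B   =
    ∈-map⁺ pushSection
           (∈-++⁺ˡ (∈-map⁺ inj₁ (cells-complete l B (later j c b) λ { refl → b<B refl })))

  arrangementᵇ-first : (u : List (Fin γ)) → arrangementᵇ (map (first {0}) u) ≡ true
  arrangementᵇ-first u = trans (all-map _ first u) (all-true u)

  arrangementᵇ-pushSection : {l : ℕ} (v : List (Cell l β γ ⊎ SectionCell)) →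
    arrangementᵇ (map pushSection v) ≡ arrangementᵇ (lefts v) ∧ sectionᵇ (rights v)
  arrangementᵇ-pushSection {l} v = begin
    all (λ x → cellSupportedᵇ x W) (map pushSection v)
      ≡⟨ all-map (λ x → cellSupportedᵇ x W) pushSection v ⟩
    all (λ y → cellSupportedᵇ (pushSection y) W) v
      ≡⟨ all-partition (λ y → cellSupportedᵇ (pushSection y) W) v ⟩
    all (λ y → cellSupportedᵇ (pushSection (inj₁ y)) W) (lefts v)
      ∧ all (λ s → cellSupportedᵇ (pushSection (inj₂ s)) W) (rights v)
      ≡⟨ cong₂ _∧_ (all-cong (lefts v) old) (all-cong (rights v) new) ⟩
    arrangementᵇ (lefts v) ∧ sectionᵇ (rights v) ∎
    where
    W : List (Cell (suc l) β γ)
    W = map pushSection v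
    old : ∀ y → cellSupportedᵇ (pushSection (inj₁ y)) W ≡ cellSupportedᵇ y (lefts v)
    old (first _)           = refl
    old (later _ _ zero)    = refl
    old (later j _ (suc b)) = begin
      any (inSectionBlockᵇ (Fin.suc j) b) (map pushSection v)
        ≡⟨ any-map (inSectionBlockᵇ (Fin.suc j) b) pushSection v ⟩
      any (inSectionBlockᵇ (Fin.suc j) b ∘ pushSection) v
        ≡⟨ any-partition (inSectionBlockᵇ (Fin.suc j) b ∘ pushSection) v ⟩
      any (inSectionBlockᵇ (Fin.suc j) b ∘ pushSection ∘ inj₁) (lefts v)
        ∨ any (inSectionBlockᵇ (Fin.suc j) b ∘ pushSection ∘ inj₂) (rights v)
        ≡⟨ cong₂ _∨_ (any-cong (lefts v) λ { (first _) → refl ; (later _ _ _) → refl })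
                     (trans (any-cong (rights v) λ { (_ , _) → refl }) (any-false (rights v))) ⟩
      any (inSectionBlockᵇ j b) (lefts v) ∨ false
        ≡⟨ Bool.∨-identityʳ _ ⟩
      any (inSectionBlockᵇ j b) (lefts v) ∎
    new : ∀ s → cellSupportedᵇ (pushSection (inj₂ s)) W ≡ supportedᵇ s (rights v)
    new (_ , zero)  = refl
    new (_ , suc b) = begin
      any (inSectionBlockᵇ (Fin.zero {l}) b) (map pushSection v)
        ≡⟨ any-map (inSectionBlockᵇ (Fin.zero {l}) b) pushSection v ⟩
      any (inSectionBlockᵇ (Fin.zero {l}) b ∘ pushSection) v
        ≡⟨ any-partition (inSectionBlockᵇ (Fin.zero {l}) b ∘ pushSection) v ⟩
      any (inSectionBlockᵇ (Fin.zero {l}) b ∘ pushSection ∘ inj₁) (lefts v)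
        ∨ any (inSectionBlockᵇ (Fin.zero {l}) b ∘ pushSection ∘ inj₂) (rights v)
        ≡⟨ cong₂ _∨_ (trans (any-cong (lefts v) λ { (first _) → refl ; (later _ _ _) → refl })
                            (any-false (lefts v)))
                     (any-cong (rights v) λ { (_ , _) → refl }) ⟩
      any (inBlockᵇ b) (rights v) ∎

-- Generating series

module Series (β γ : ℕ) where

  open Sections β
  open Arrangements β γ

  expMinusOne : EGF
  expMinusOne zero    = + 0
  expMinusOne (suc k) = expS β (suc k)

  twoMinusExp-split : ∀ k → twoMinusExp β k ≡ oneS k + - expMinusOne k
  twoMinusExp-split zero    = refl
  twoMinusExp-split (suc k) = refl

  countEGF-nonEmpty : ∀ k → countEGF (allFin β) (not ∘ null) k ≡ expMinusOne k
  countEGF-nonEmpty zero    = refl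
  countEGF-nonEmpty (suc k) = cong +_ (begin
    count (allFin β) (suc k) (not ∘ null)
      ≡⟨ count-cong (suc k) (allFin β) {not ∘ null} {λ _ → true} (λ { (_ ∷ _) _ → refl }) ⟩
    count (allFin β) (suc k) (λ _ → true)
      ≡⟨ count-true (suc k) (allFin β) ⟩
    length (allFin β) ℕ.^ suc k
      ≡⟨ cong (ℕ._^ suc k) (List.length-tabulate {n = β} id) ⟩
    β ℕ.^ suc k ∎)

  ⊛-expMinusOne-cong : ∀ m {f f′ : EGF} → (∀ k → k ≤ m → f k ≡ f′ k) →
                       (f ⊛ expMinusOne) (suc m) ≡ (f′ ⊛ expMinusOne) (suc m)
  ⊛-expMinusOne-cong m {f} {f′} f≗f′ = cong₂ _+_
    (sumTo-cong m λ k k≤m → cong (λ a → + (suc m C k) * a * expMinusOne (suc m ∸ k)) (f≗f′ k k≤m))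
    (trans (last f) (sym (last f′)))
    where
    last : (g : EGF) → ⊛-term g expMinusOne (suc m) (suc m) ≡ + 0
    last g = trans (⊛-term-last (suc m) g expMinusOne) (ℤ.*-zeroʳ (g (suc m)))

  sectionEGF : ℕ → EGF
  sectionEGF B = countEGF (sectionCells B) sectionᵇ

  -- the first block of a nonempty section is a nonempty word over the β compartments
  sectionEGF-suc : ∀ B m → sectionEGF (suc B) (suc m) ≡ (sectionEGF B ⊛ expMinusOne) (suc m)
  sectionEGF-suc B m = begin
    + count (map pushBlock alphabet) (suc m) sectionᵇ
      ≡⟨ cong +_ (count-map (suc m) pushBlock alphabet sectionᵇ) ⟩
    + count alphabet (suc m) (sectionᵇ ∘ map pushBlock)
      ≡⟨ cong +_ (count-cong (suc m) alphabet {sectionᵇ ∘ map pushBlock} {splitSectionᵇ}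
                     λ { (x ∷ v) _ → sectionᵇ-pushBlock (x ∷ v) λ () }) ⟩
    + count alphabet (suc m) splitSectionᵇ
      ≡⟨ count-⊎ (suc m) (sectionCells B) (allFin β) sectionᵇ (not ∘ null) ⟩
    (sectionEGF B ⊛ countEGF (allFin β) (not ∘ null)) (suc m)
      ≡⟨ ⊛-congʳ (suc m) (sectionEGF B) (λ k _ → countEGF-nonEmpty k) ⟩
    (sectionEGF B ⊛ expMinusOne) (suc m) ∎
    where
    alphabet : List (SectionCell ⊎ Fin β)
    alphabet = map inj₁ (sectionCells B) ++ map inj₂ (allFin β)
    splitSectionᵇ : List (SectionCell ⊎ Fin β) → Bool
    splitSectionᵇ v = sectionᵇ (lefts v) ∧ not (null (rights v))

  sectionSeries : EGF
  sectionSeries k = sectionEGF k k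

  -- a section of size k only uses blocks below k
  sectionEGF-stable : ∀ k B → k ≤ B → sectionEGF B k ≡ sectionSeries k
  sectionEGF-stable = <-rec _ stable
    where
    stable : ∀ k → (∀ {j} → j < k → ∀ B → j ≤ B → sectionEGF B j ≡ sectionSeries j) →
             ∀ B → k ≤ B → sectionEGF B k ≡ sectionSeries k
    stable zero    _  _       _         = refl
    stable (suc m) ih (suc B) (s≤s m≤B) = begin
      sectionEGF (suc B) (suc m)        ≡⟨ sectionEGF-suc B m ⟩
      (sectionEGF B ⊛ expMinusOne) (suc m)
        ≡⟨ ⊛-expMinusOne-cong m (λ j j≤m → ih (s≤s j≤m) B (ℕ.≤-trans j≤m m≤B)) ⟩
      (sectionSeries ⊛ expMinusOne) (suc m)
        ≡⟨ ⊛-expMinusOne-cong m (λ j j≤m → ih (s≤s j≤m) m j≤m) ⟨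
      (sectionEGF m ⊛ expMinusOne) (suc m) ≡⟨ sectionEGF-suc m m ⟨
      sectionEGF (suc m) (suc m)        ∎

  sectionSeries-suc : ∀ m → sectionSeries (suc m) ≡ (sectionSeries ⊛ expMinusOne) (suc m)
  sectionSeries-suc m =
    trans (sectionEGF-suc m m) (⊛-expMinusOne-cong m (λ j j≤m → sectionEGF-stable j m j≤m))

  sectionSeries-⊛-twoMinusExp : ∀ n → (sectionSeries ⊛ twoMinusExp β) n ≡ oneS n
  sectionSeries-⊛-twoMinusExp n = begin
    (sectionSeries ⊛ twoMinusExp β) n
      ≡⟨ ⊛-congʳ n sectionSeries (λ k _ → twoMinusExp-split k) ⟩
    (sectionSeries ⊛ (λ k → oneS k + - expMinusOne k)) n
      ≡⟨ ⊛-distribˡ n sectionSeries oneS (λ k → - expMinusOne k) ⟩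
    (sectionSeries ⊛ oneS) n + (sectionSeries ⊛ (λ k → - expMinusOne k)) n
      ≡⟨ cong₂ _+_ (⊛-identityʳ n sectionSeries) (⊛-negʳ n sectionSeries expMinusOne) ⟩
    sectionSeries n + - (sectionSeries ⊛ expMinusOne) n
      ≡⟨ cancel n ⟩
    oneS n ∎
    where
    cancel : ∀ n → sectionSeries n + - (sectionSeries ⊛ expMinusOne) n ≡ oneS n
    cancel zero    = refl
    cancel (suc m) = trans (cong (_+ - (sectionSeries ⊛ expMinusOne) (suc m)) (sectionSeries-suc m))
                           (ℤ.+-inverseʳ ((sectionSeries ⊛ expMinusOne) (suc m)))

  arrangementEGF : (l B : ℕ) → EGF
  arrangementEGF l B = countEGF (cells l B) arrangementᵇ

  arrangementSeries : ℕ → EGF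
  arrangementSeries zero    = expS γ
  arrangementSeries (suc l) = arrangementSeries l ⊛ sectionSeries

  arrangementEGF-zero : ∀ B k → arrangementEGF 0 B k ≡ expS γ k
  arrangementEGF-zero B k = cong +_ (begin
    count (map first (allFin γ)) k arrangementᵇ
      ≡⟨ count-map k first (allFin γ) arrangementᵇ ⟩
    count (allFin γ) k (arrangementᵇ ∘ map first)
      ≡⟨ count-cong k (allFin γ) (λ v _ → arrangementᵇ-first v) ⟩
    count (allFin γ) k (λ _ → true)
      ≡⟨ count-true k (allFin γ) ⟩
    length (allFin γ) ℕ.^ k
      ≡⟨ cong (ℕ._^ k) (List.length-tabulate {n = γ} id) ⟩
    γ ℕ.^ k ∎)

  arrangementEGF-suc : ∀ l B n → arrangementEGF (suc l) B n ≡ (arrangementEGF l B ⊛ sectionEGF B) n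
  arrangementEGF-suc l B n = begin
    + count (map pushSection alphabet) n arrangementᵇ
      ≡⟨ cong +_ (count-map n pushSection alphabet arrangementᵇ) ⟩
    + count alphabet n (arrangementᵇ ∘ map pushSection)
      ≡⟨ cong +_ (count-cong n alphabet (λ v _ → arrangementᵇ-pushSection v)) ⟩
    + count alphabet n (λ v → arrangementᵇ (lefts v) ∧ sectionᵇ (rights v))
      ≡⟨ count-⊎ n (cells l B) (sectionCells B) arrangementᵇ sectionᵇ ⟩
    (arrangementEGF l B ⊛ sectionEGF B) n ∎
    where
    alphabet : List (Cell l β γ ⊎ SectionCell)
    alphabet = map inj₁ (cells l B) ++ map inj₂ (sectionCells B)

  arrangementEGF-stable : ∀ l B n → n ≤ B → arrangementEGF l B n ≡ arrangementSeries l n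
  arrangementEGF-stable zero    B n _   = arrangementEGF-zero B n
  arrangementEGF-stable (suc l) B n n≤B = trans (arrangementEGF-suc l B n)
    (⊛-cong n (λ k k≤n → arrangementEGF-stable l B k (ℕ.≤-trans k≤n n≤B))
              (λ k k≤n → sectionEGF-stable k B (ℕ.≤-trans k≤n n≤B)))

  arrangementSeries-isH : ∀ l → IsH l β γ (arrangementSeries l)
  arrangementSeries-isH zero    n = ⊛-identityʳ n (expS γ)
  arrangementSeries-isH (suc l) n = begin
    ((H ⊛ G) ⊛ (P ⊛ P^l)) n
      ≡⟨ ⊛-assoc n H G (P ⊛ P^l) ⟩
    (H ⊛ (G ⊛ (P ⊛ P^l))) n
      ≡⟨ ⊛-congʳ n H (λ k _ → ⊛-assoc k G P P^l) ⟨
    (H ⊛ ((G ⊛ P) ⊛ P^l)) n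
      ≡⟨ ⊛-congʳ n H (λ k _ → ⊛-congˡ k P^l λ j _ → sectionSeries-⊛-twoMinusExp j) ⟩
    (H ⊛ (oneS ⊛ P^l)) n
      ≡⟨ ⊛-congʳ n H (λ k _ → ⊛-identityˡ k P^l) ⟩
    (H ⊛ P^l) n
      ≡⟨ arrangementSeries-isH l n ⟩
    expS γ n ∎
    where
    H G P P^l : EGF
    H   = arrangementSeries l
    G   = sectionSeries
    P   = twoMinusExp β
    P^l = P ^S l

-- Arrangements as vectors of cells

module Enumeration (β γ : ℕ) where

  open Sections β
  open Arrangements β γ

  inSectionBlockᵇ-sound : {l : ℕ} {j : Fin l} {b : ℕ} (x : Cell l β γ) →
                          T (inSectionBlockᵇ j b x) → ∃ λ c → x ≡ later j c b
  inSectionBlockᵇ-sound {j = j} {b} (later j′ c b′) t with j Fin.≟ j′ | t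
  ... | yes refl | b≡ᵇb′ = c , cong (later j c) (sym (ℕ.≡ᵇ⇒≡ b b′ b≡ᵇb′))

  inSectionBlockᵇ-later : {l : ℕ} (j : Fin l) (c : Fin β) (b : ℕ) →
                          T (inSectionBlockᵇ j b (later j c b))
  inSectionBlockᵇ-later j c b rewrite dec-true (j Fin.≟ j) refl = ℕ.≡⇒≡ᵇ b b refl

  module _ {l n : ℕ} (v : Vec (Cell l β γ) n) where

    arrangementᵇ⇒ValidArr : T (arrangementᵇ (toList v)) → ValidArr l β γ n v
    arrangementᵇ⇒ValidArr valid i j c b vᵢ≡ =
      let supported = All.lookup (all⁺ _ (toList v) valid) (∈-toList⁺ (∈-lookup i v))
          y , y∈v , y∈block =
            find (any⁻ _ (toList v) (subst (λ x → T (cellSupportedᵇ x (toList v))) vᵢ≡ supported))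
          c′ , y≡ = inSectionBlockᵇ-sound y y∈block
          i′ , vᵢ′≡y = ∈-toList⇒lookup v y∈v
      in i′ , c′ , trans vᵢ′≡y y≡

    ValidArr⇒arrangementᵇ : ValidArr l β γ n v → T (arrangementᵇ (toList v))
    ValidArr⇒arrangementᵇ valid =
      all⁻ _ (All.tabulate λ {x} x∈v → supported x (∈-toList⇒lookup v x∈v))
      where
      supported : ∀ x → (∃ λ i → lookup v i ≡ x) → T (cellSupportedᵇ x (toList v))
      supported (first _)           _          = _
      supported (later _ _ zero)    _          = _
      supported (later j c (suc b)) (i , vᵢ≡) =
        let i′ , c′ , vᵢ′≡ = valid i j c b vᵢ≡
        in any⁺ _ (lose (∈-toList⁺ (∈-lookup i′ v))
                        (subst (T ∘ inSectionBlockᵇ j b) (sym vᵢ′≡) (inSectionBlockᵇ-later j c′ b)))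

    ValidArr-downward : ValidArr l β γ n v → ∀ {i j c b} → lookup v i ≡ later j c b →
                        ∀ k → k ≤ b → ∃₂ λ i′ c′ → lookup v i′ ≡ later j c′ k
    ValidArr-downward valid {i} {b = zero}  vᵢ≡ zero ℕ.z≤n = i , _ , vᵢ≡
    ValidArr-downward valid {i} {j} {c} {suc b} vᵢ≡ k k≤1+b with ℕ.m≤n⇒m<n∨m≡n k≤1+b
    ... | inj₂ refl      = i , c , vᵢ≡
    ... | inj₁ (s≤s k≤b) =
      let i′ , _ , vᵢ′≡ = valid i j c b vᵢ≡ in ValidArr-downward valid vᵢ′≡ k k≤b

    -- blocks 0, …, b of the section are occupied by distinct elements
    ValidArr-block< : ValidArr l β γ n v → ∀ {i j c b} → lookup v i ≡ later j c b → b < n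
    ValidArr-block< valid {b = b} vᵢ≡ = Fin.injective⇒≤ injective
      where
      occupant : (k : Fin (suc b)) → ∃₂ λ i′ c′ → lookup v i′ ≡ later _ c′ (toℕ k)
      occupant k = ValidArr-downward valid vᵢ≡ (toℕ k) (Fin.toℕ≤pred[n] k)
      block : Cell l β γ → ℕ
      block (first _)     = 0
      block (later _ _ b) = b
      block-occupant : ∀ k → block (lookup v (proj₁ (occupant k))) ≡ toℕ k
      block-occupant k = cong block (proj₂ (proj₂ (occupant k)))
      injective : ∀ {k k′} → proj₁ (occupant k) ≡ proj₁ (occupant k′) → k ≡ k′
      injective {k} {k′} eq = Fin.toℕ-injective
        (trans (sym (block-occupant k)) (trans (cong (block ∘ lookup v) eq) (block-occupant k′)))

  ValidArr-hasCard : ∀ l n → HasCard (ValidArr l β γ n) (count (cells l n) n arrangementᵇ)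
  ValidArr-hasCard l n = count-hasCard (cells l n) arrangementᵇ (cells-unique l n)
    (λ {v} valid i → cells-complete l n (lookup v i) (ValidArr-block< v valid))
    (λ {v} → ValidArr⇒arrangementᵇ v) (λ {v} → arrangementᵇ⇒ValidArr v)

theorem6 : (l β γ : ℕ) → ¬ (l ≡ 0 × γ ≡ 0) → 1 ≤ β →
    Σ EGF λ h → IsH l β γ h ×
    (∀ h' → IsH l β γ h' → ∀ n →
    Σ ℕ λ m → h' n ≡ + m × HasCard (ValidArr l β γ n) m)
theorem6 l β γ _ _ =
  arrangementSeries l , arrangementSeries-isH l , λ h′ h′-isH n →
    count (cells l n) n arrangementᵇ ,
    trans (IsH-unique l β γ h′-isH (arrangementSeries-isH l) n) (sym (arrangementEGF-stable l n n ℕ.≤-refl)) ,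
    ValidArr-hasCard l n
  where
  open Arrangements β γ
  open Series β γ
  open Enumeration β γ
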